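{- Let $W$ be any George group of window size $n$ (one of $S_n$, $S^B_n$, $S^D_n$, $\widetilde{S}_n$, $\widetilde{S}^C_n$, $\widetilde{S}^B_n$, $\widetilde{S}^D_n$), let $w\in W$, and let $\{x,y\}$ be a transposable pair for $W$ such that $w(x)\ge y>x\ge w(y)$. Then \[ \operatorname{tvd}(w\cdot\langle(x~y)\rangle)=\operatorname{tvd}(w)-\operatorname{tvd}(\langle(x~y)\rangle). \]
   Context: Fix a positive integer $n$, $[n]=\{1,\dots,n\}$, $\pm[n]=\{\pm1,\dots,\pm n\}$. $S_n$: bijections of $[n]$. $S^B_n$: bijections $w$ of $\pm[n]$ with $w(-i)=-w(i)$. $S^D_n$: elements of $S^B_n$ with $\#\{i\in[n]: w(i)<0\}$ even. $\widetilde{S}_n$: bijections $w:\mathbb{Z}\to\mathbb{Z}$ with $w(i+n)=w(i)+n$ for all $i$ and $w(1)+\cdots+w(n)=\binom{n+1}{2}$. $\widetilde{S}^C_n$: bijections $w:\mathbb{Z}\to\mathbb{Z}$ with $w(-i)=-w(i)$ and $w(i+2n+2)=w(i)+2n+2$ for all $i$. $\widetilde{S}^B_n$: elements of $\widetilde{S}^C_n$ with $\#\{i>0: w(i)<0\}$ even. $\widetilde{S}^D_n$: elements of $\widetilde{S}^B_n$ with also $\#\{i>n+1: w(i)<n+1\}$ even. Products are compositions, so $(w\cdot t)(i)=w(t(i))$. The total displacement is $\operatorname{tvd}(w)=\sum_{i=1}^n|w(i)-i|$. A pair $\{x,y\}$ of distinct elements of the domain is transposable for $W$ if some $u\in W$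 has $u(x)=y$, $u(y)=x$; the transposition $\langle(x~y)\rangle$ is the involution in $W$ obtained by extending $(x~y)$ by the defining symmetries of $W$: for every map $g$ in the group generated by the defining symmetries (none for $S_n$; $i\mapsto -i$ for $S^B_n,S^D_n$; $i\mapsto i+n$ for $\widetilde{S}_n$; $i\mapsto -i$ and $i\mapsto i+2n+2$ for $\widetilde{S}^C_n,\widetilde{S}^B_n,\widetilde{S}^D_n$) it interchanges $g(x)$ and $g(y)$, fixing all other points. -}

module Defs where

open import Data.Nat as ℕ using (ℕ; zero; suc)
open import Data.Nat.Divisibility using (_∣_)
open import Data.Integer as ℤ using (ℤ; +_; -_; _+_; _-_; _*_; _<_; _≤_; _>_; ∣_∣; 0ℤ; 1ℤ)
open import Data.List using (List; length)
open import Data.List.Membership.Propositional using (_∈_)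
open import Data.List.Relation.Unary.Unique.Propositional using (Unique)
open import Data.Product using (Σ; ∃; ∃-syntax; _×_; _,_)
open import Data.Sum using (_⊎_)
open import Data.Unit using (⊤)
open import Data.Empty using (⊥)
open import Function using (_∘_)
open import Function.Bundles using (_⇔_)
open import Relation.Binary.PropositionalEquality using (_≡_; _≢_)

-- The seven George types (window size n).
--   SA  = S_n,  SB = S^B_n,  SD = S^D_n,
--   ASA = affine S~_n, ASC = S~^C_n, ASB = S~^B_n, ASD = S~^D_n.

data GeorgeType : Set where
  SA SB SD ASA ASC ASB ASD : GeorgeType

-- Whether i ↦ -i is among the defining symmetries.
symmetric : GeorgeType → Set
symmetric SA  = ⊥
symmetric SB  = ⊤
symmetric SD  = ⊤
symmetric ASA = ⊥
symmetric ASC = ⊤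
symmetric ASB = ⊤
symmetric ASD = ⊤

-- Period of the translation symmetry (0 = no translation symmetry).
period : GeorgeType → ℕ → ℤ
period SA  n = 0ℤ
period SB  n = 0ℤ
period SD  n = 0ℤ
period ASA n = + n
period ASC n = + (2 ℕ.* n ℕ.+ 2)
period ASB n = + (2 ℕ.* n ℕ.+ 2)
period ASD n = + (2 ℕ.* n ℕ.+ 2)

-- g is in the group generated by the defining symmetries:
-- g(i) = s·i + k·N with s = 1, or s = -1 when i ↦ -i is a symmetry.
data Sign (T : GeorgeType) : Set where
  plus  : Sign T
  minus : symmetric T → Sign T

signVal : ∀ {T} → Sign T → ℤ
signVal plus      = 1ℤ
signVal (minus _) = - 1ℤ

symMap : (T : GeorgeType) (n : ℕ) → Sign T → ℤ → ℤ → ℤ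
symMap T n s k i = signVal s * i + k * period T n

InDomain : GeorgeType → ℕ → ℤ → Set
InDomain SA  n i = (+ 1 ≤ i) × (i ≤ + n)
InDomain SB  n i = ((+ 1 ≤ i) × (i ≤ + n)) ⊎ ((+ 1 ≤ - i) × (- i ≤ + n))
InDomain SD  n i = ((+ 1 ≤ i) × (i ≤ + n)) ⊎ ((+ 1 ≤ - i) × (- i ≤ + n))
InDomain ASA n i = ⊤
InDomain ASC n i = ⊤
InDomain ASB n i = ⊤
InDomain ASD n i = ⊤

IsBij : (ℤ → ℤ) → Set
IsBij w = Σ (ℤ → ℤ) λ v → ((∀ i → w (v i) ≡ i) × (∀ i → v (w i) ≡ i))

EvenCard : (ℤ → Set) → Set
EvenCard P = Σ (List ℤ) λ L → (Unique L × (2 ∣ length L) × (∀ i → (i ∈ L) ⇔ P i))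

sumTo : (ℤ → ℤ) → ℕ → ℤ
sumTo f zero    = 0ℤ
sumTo f (suc m) = sumTo f m + f (+ suc m)

-- Finite groups are encoded as bijections of ℤ fixing every point
-- outside the domain [n] resp. ±[n].
FixOutside : GeorgeType → ℕ → (ℤ → ℤ) → Set
FixOutside T n w = ∀ i → (InDomain T n i → ⊥) → w i ≡ i

Odd-sym : (ℤ → ℤ) → Set
Odd-sym w = ∀ i → w (- i) ≡ - w i

Periodic : ℤ → (ℤ → ℤ) → Set
Periodic N w = ∀ i → w (i + N) ≡ w i + N

InAffC : ℕ → (ℤ → ℤ) → Set
InAffC n w = IsBij w × Odd-sym w × Periodic (+ (2 ℕ.* n ℕ.+ 2)) w

InGroup : GeorgeType → ℕ → (ℤ → ℤ) → Set
InGroup SA  n w = IsBij w × FixOutside SA n w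
InGroup SB  n w = IsBij w × FixOutside SB n w × Odd-sym w
InGroup SD  n w = IsBij w × FixOutside SD n w × Odd-sym w
                  × EvenCard (λ i → (+ 1 ≤ i) × (i ≤ + n) × (w i < 0ℤ))
InGroup ASA n w = IsBij w × Periodic (+ n) w
                  × (sumTo w n ≡ + ((n ℕ.* (n ℕ.+ 1)) ℕ./ 2))
InGroup ASC n w = InAffC n w
InGroup ASB n w = InAffC n w
                  × EvenCard (λ i → (i > 0ℤ) × (w i < 0ℤ))
InGroup ASD n w = InAffC n w
                  × EvenCard (λ i → (i > 0ℤ) × (w i < 0ℤ))
                  × EvenCard (λ i → (i > + (n ℕ.+ 1)) × (w i < + (n ℕ.+ 1)))

Transposable : GeorgeType → ℕ → ℤ → ℤ → Set
Transposable T n x y =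
  (x ≢ y) × InDomain T n x × InDomain T n y
  × ∃[ u ] (InGroup T n u × (u x ≡ y) × (u y ≡ x))

-- t is the transposition ⟨(x y)⟩: for every g in the symmetry group it
-- interchanges g(x) and g(y), and it fixes all other points.
IsTransposition : GeorgeType → ℕ → ℤ → ℤ → (ℤ → ℤ) → Set
IsTransposition T n x y t =
  (∀ (s : Sign T) (k : ℤ) →
     (t (symMap T n s k x) ≡ symMap T n s k y)
     × (t (symMap T n s k y) ≡ symMap T n s k x))
  × (∀ i → (∀ (s : Sign T) (k : ℤ) →
              (i ≢ symMap T n s k x) × (i ≢ symMap T n s k y))
         → t i ≡ i)

tvd : ℕ → (ℤ → ℤ) → ℕ
tvd zero    w = 0
tvd (suc m) w = tvd m w ℕ.+ ∣ w (+ suc m) - + suc m ∣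

-- Write tvd(w ∘ t) + tvd(t) − tvd(w) as the window sum of the defect
-- δ(i) = |w(t i) − i| + |t i − i| − |w i − i|.  The transposition t fixes every
-- point outside the orbits of x and y under the defining symmetries, so δ vanishes
-- there.  The symmetries are isometries of ℤ commuting with w, and t interchanges
-- g x and g y for every symmetry g, so δ is constant on each orbit: it equals D on
-- the orbit of x and, because w(x) ≥ y > x ≥ w(y) resolves all absolute values,
-- −D on the orbit of y.  Points of one orbit differ (or, under i ↦ −i, add up) by a
-- multiple of the period 0, n or 2n + 2, whereas two window points differ by less
-- than n and add up to between 2 and 2n; so each orbit meets the window [n] exactly
-- once, and the sum is D − D = 0.

module Submission where

open import Defs
open import Data.Nat as ℕ using (ℕ; zero; suc; s≤s; z≤n)
import Data.Nat.Properties as ℕ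
import Data.Nat.Tactic.RingSolver as NS
open import Data.Integer using (_/ℕ_; _%ℕ_; ℤ; +_; +[1+_]; -[1+_]; -_; _+_; _-_; _*_; _≤_; _<_; ∣_∣; 0ℤ; 1ℤ; -1ℤ; +≤+; _≟_)
open import Data.Integer.Properties
open import Data.Integer.DivMod using (n%ℕd<d; a≡a%ℕn+[a/ℕn]*n)
open import Data.Integer.Tactic.RingSolver using (solve-∀)
open import Data.Product using (_×_; _,_; proj₁; proj₂; ∃; ∃₂)
open import Data.Sum using (_⊎_; inj₁; inj₂)
import Data.Sum as Sum
open import Data.Unit using (tt)
open import Function using (_∘_)
open import Relation.Nullary using (Dec; yes; no; contradiction)
open import Relation.Binary.PropositionalEquality

-- Sums over the window [n]

InWindow : ℕ → ℤ → Set
InWindow = InDomain SA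

sumTo-cong : ∀ {n f g} → (∀ i → InWindow n i → f i ≡ g i) → sumTo f n ≡ sumTo g n
sumTo-cong {n} {f} {g} f≗g = go n ℕ.≤-refl
  where
  go : ∀ m → m ℕ.≤ n → sumTo f m ≡ sumTo g m
  go zero    _   = refl
  go (suc m) m<n = cong₂ _+_ (go m (ℕ.<⇒≤ m<n)) (f≗g (+ suc m) (+≤+ (s≤s z≤n) , +≤+ m<n))

sumTo-+ : ∀ f g m → sumTo (λ i → f i + g i) m ≡ sumTo f m + sumTo g m
sumTo-+ f g zero    = refl
sumTo-+ f g (suc m) =
  trans (cong (_+ (f i + g i)) (sumTo-+ f g m)) (interchange (sumTo f m) (sumTo g m) (f i) (g i))
  where
  i = + suc m
  interchange : ∀ a b c d → a + b + (c + d) ≡ a + c + (b + d)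
  interchange = solve-∀

single : ℤ → ℤ → ℤ → ℤ
single p D i with i ≟ p
... | yes _ = D
... | no  _ = 0ℤ

single-≡ : ∀ {p i} D → i ≡ p → single p D i ≡ D
single-≡ {p} {i} D i≡p with i ≟ p
... | yes _   = refl
... | no i≢p = contradiction i≡p i≢p

single-≢ : ∀ {p i} D → i ≢ p → single p D i ≡ 0ℤ
single-≢ {p} {i} D i≢p with i ≟ p
... | yes i≡p = contradiction i≡p i≢p
... | no _    = refl

sumTo-single : ∀ {n p} D → InWindow n p → sumTo (single p D) n ≡ D
sumTo-single {p = + zero} D (+≤+ () , _)
sumTo-single {n} {+[1+ j ]} D (_ , +≤+ j<n) = above n j<n
  where
  p = +[1+ j ]
  below : ∀ m → m ℕ.≤ j → sumTo (single p D) m ≡ 0ℤ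
  below zero    _   = refl
  below (suc m) m<j = cong₂ _+_ (below m (ℕ.<⇒≤ m<j)) (single-≢ D (ℕ.<⇒≢ (s≤s m<j) ∘ +-injective))
  above : ∀ m → j ℕ.< m → sumTo (single p D) m ≡ D
  above (suc m) (s≤s j≤m) with ℕ.m≤n⇒m<n∨m≡n j≤m
  ... | inj₁ j<m  =
    trans (cong₂ _+_ (above m j<m) (single-≢ D (ℕ.>⇒≢ (s≤s j<m) ∘ +-injective))) (+-identityʳ D)
  ... | inj₂ refl = trans (cong₂ _+_ (below j ℕ.≤-refl) (single-≡ D refl)) (+-identityˡ D)

defect : (ℤ → ℤ) → (ℤ → ℤ) → ℤ → ℤ
defect w t i = + ∣ w (t i) - i ∣ + + ∣ t i - i ∣ - + ∣ w i - i ∣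

sumTo-defect : ∀ w t m → sumTo (defect w t) m ≡ + tvd m (w ∘ t) + + tvd m t - + tvd m w
sumTo-defect w t zero    = refl
sumTo-defect w t (suc m) = begin
  sumTo (defect w t) m + defect w t i
    ≡⟨ cong (_+ defect w t i) (sumTo-defect w t m) ⟩
  (+ tvd m (w ∘ t) + + tvd m t - + tvd m w) + (dwt + dt - dw)
    ≡⟨ regroup (+ tvd m (w ∘ t)) (+ tvd m t) (+ tvd m w) dwt dt dw ⟩
  (+ tvd m (w ∘ t) + dwt) + (+ tvd m t + dt) - (+ tvd m w + dw)
    ≡⟨ sym (cong₂ _-_ (cong₂ _+_ (pos-+ (tvd m (w ∘ t)) _) (pos-+ (tvd m t) _)) (pos-+ (tvd m w) _)) ⟩
  + tvd (suc m) (w ∘ t) + + tvd (suc m) t - + tvd (suc m) w ∎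
  where
  open ≡-Reasoning
  i = + suc m
  dwt = + ∣ w (t i) - i ∣
  dt  = + ∣ t i - i ∣
  dw  = + ∣ w i - i ∣
  regroup : ∀ a b c d e f → (a + b - c) + (d + e - f) ≡ (a + d) + (b + e) - (c + f)
  regroup = solve-∀

defect-fixed : ∀ {w t i} → t i ≡ i → defect w t i ≡ 0ℤ
defect-fixed {w} {t} {i} ti≡i rewrite ti≡i | +-inverseʳ i = cancel (+ ∣ w i - i ∣)
  where
  cancel : ∀ a → a + 0ℤ - a ≡ 0ℤ
  cancel = solve-∀

swapDefect : (ℤ → ℤ) → ℤ → ℤ → ℤ
swapDefect w a b = + ∣ w b - a ∣ + + ∣ b - a ∣ - + ∣ w a - a ∣

∣-∣-≥ : ∀ {i j} → i ≤ j → + ∣ j - i ∣ ≡ j - i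
∣-∣-≥ {i} {j} i≤j = trans (cong +_ (∣i-j∣≡∣j-i∣ j i)) (∣-∣-≤ i≤j)

swapDefect-antisym : ∀ {w x y} → y ≤ w x → x < y → w y ≤ x → swapDefect w y x ≡ - swapDefect w x y
swapDefect-antisym {w} {x} {y} y≤wx x<y wy≤x = begin
  swapDefect w y x
    ≡⟨ cong₂ _-_ (cong₂ _+_ (∣-∣-≥ y≤wx) (∣-∣-≤ x≤y)) (∣-∣-≤ (≤-trans wy≤x x≤y)) ⟩
  (w x - y) + (y - x) - (y - w y)
    ≡⟨ identity (w x) (w y) x y ⟩
  - ((x - w y) + (y - x) - (w x - x))
    ≡⟨ sym (cong -_ (cong₂ _-_ (cong₂ _+_ (∣-∣-≤ wy≤x) (∣-∣-≥ x≤y)) (∣-∣-≥ (≤-trans x≤y y≤wx)))) ⟩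
  - swapDefect w x y ∎
  where
  open ≡-Reasoning
  x≤y = <⇒≤ x<y
  identity : ∀ a b x y → (a - y) + (y - x) - (y - b) ≡ - ((x - b) + (y - x) - (a - x))
  identity = solve-∀

i≡-i⇒i≡0 : ∀ {i} → i ≡ - i → i ≡ 0ℤ
i≡-i⇒i≡0 {+ zero}   _  = refl
i≡-i⇒i≡0 {+[1+ _ ]} ()
i≡-i⇒i≡0 { -[1+ _ ]} ()

a+b-c≡0⇒a≡c-b : ∀ a b c → a + b - c ≡ 0ℤ → a ≡ c - b
a+b-c≡0⇒a≡c-b a b c eq = begin
  a                     ≡⟨ shift a b c ⟩
  (a + b - c) + (c - b) ≡⟨ cong (_+ (c - b)) eq ⟩
  0ℤ + (c - b)          ≡⟨ +-identityˡ (c - b) ⟩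
  c - b ∎
  where
  open ≡-Reasoning
  shift : ∀ a b c → a ≡ (a + b - c) + (c - b)
  shift = solve-∀

-- Transpositions of orbits under an isometric action

Equivariant : {G : Set} → (G → ℤ → ℤ) → (ℤ → ℤ) → Set
Equivariant act w = ∀ g i → w (act g i) ≡ act g (w i)

SwapsOrbits : {G : Set} → (G → ℤ → ℤ) → ℤ → ℤ → (ℤ → ℤ) → Set
SwapsOrbits act x y t =
  (∀ g → (t (act g x) ≡ act g y) × (t (act g y) ≡ act g x))
  × (∀ i → (∀ g → (i ≢ act g x) × (i ≢ act g y)) → t i ≡ i)

MeetsWindow : {G : Set} → (G → ℤ → ℤ) → ℕ → ℤ → Set
MeetsWindow act n z = ∃ λ g → InWindow n (act g z)

module OrbitTransposition {G : Set} (act : G → ℤ → ℤ) (n : ℕ)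
  (act-isometry : ∀ g i j → ∣ act g i - act g j ∣ ≡ ∣ i - j ∣)
  (window-transversal : ∀ g h z → InWindow n (act g z) → InWindow n (act h z) → act g z ≡ act h z)
  where

  defect-orbit : ∀ {w t a b} → Equivariant act w → ∀ g → t (act g a) ≡ act g b
    → defect w t (act g a) ≡ swapDefect w a b
  defect-orbit {w} {t} {a} {b} w-equiv g tga≡gb
    rewrite tga≡gb | w-equiv g b | w-equiv g a
          | act-isometry g (w b) a | act-isometry g b a | act-isometry g (w a) a
    = refl

  tvd-∘-swap : ∀ {w t x y} → Equivariant act w → SwapsOrbits act x y t
    → MeetsWindow act n x → MeetsWindow act n y
    → y ≤ w x → x < y → w y ≤ x
    → + tvd n (w ∘ t) ≡ + tvd n w - + tvd n t
  tvd-∘-swap {w} {t} {x} {y} w-equiv (swaps , fixes) (gx , p∈) (gy , q∈) y≤wx x<y wy≤x =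
    a+b-c≡0⇒a≡c-b (+ tvd n (w ∘ t)) (+ tvd n t) (+ tvd n w) (begin
      + tvd n (w ∘ t) + + tvd n t - + tvd n w         ≡⟨ sumTo-defect w t n ⟨
      sumTo (defect w t) n                             ≡⟨ sumTo-cong pointwise ⟩
      sumTo (λ i → single p D i + single q (- D) i) n  ≡⟨ sumTo-+ (single p D) (single q (- D)) n ⟩
      sumTo (single p D) n + sumTo (single q (- D)) n  ≡⟨ cong₂ _+_ (sumTo-single D p∈) (sumTo-single (- D) q∈) ⟩
      D - D                                            ≡⟨ +-inverseʳ D ⟩
      0ℤ ∎)
    where
    open ≡-Reasoning
    p = act gx x
    q = act gy y
    D = swapDefect w x y

    defect-p : ∀ {i} → i ≡ p → defect w t i ≡ D
    defect-p refl = defect-orbit {t = t} w-equiv gx (proj₁ (swaps gx))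

    defect-q : ∀ {i} → i ≡ q → defect w t i ≡ - D
    defect-q refl = trans (defect-orbit {t = t} w-equiv gy (proj₂ (swaps gy))) (swapDefect-antisym y≤wx x<y wy≤x)

    off-orbits : ∀ {i} → InWindow n i → i ≢ p → i ≢ q → ∀ g → (i ≢ act g x) × (i ≢ act g y)
    off-orbits i∈ i≢p i≢q g =
        (λ { refl → i≢p (window-transversal g gx x i∈ p∈) })
      , (λ { refl → i≢q (window-transversal g gy y i∈ q∈) })

    pointwise : ∀ i → InWindow n i → defect w t i ≡ single p D i + single q (- D) i
    pointwise i i∈ = by-cases (i ≟ p) (i ≟ q)
      where
      by-cases : Dec (i ≡ p) → Dec (i ≡ q) → defect w t i ≡ single p D i + single q (- D) i
      by-cases (yes i≡p) (yes i≡q) = begin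
        defect w t i   ≡⟨ defect-p i≡p ⟩
        D              ≡⟨ i≡-i⇒i≡0 (trans (sym (defect-p i≡p)) (defect-q i≡q)) ⟩
        0ℤ             ≡⟨ +-inverseʳ D ⟨
        D - D          ≡⟨ cong₂ _+_ (single-≡ D i≡p) (single-≡ (- D) i≡q) ⟨
        single p D i + single q (- D) i ∎
      by-cases (yes i≡p) (no i≢q) = begin
        defect w t i   ≡⟨ defect-p i≡p ⟩
        D              ≡⟨ +-identityʳ D ⟨
        D + 0ℤ         ≡⟨ cong₂ _+_ (single-≡ D i≡p) (single-≢ (- D) i≢q) ⟨
        single p D i + single q (- D) i ∎
      by-cases (no i≢p) (yes i≡q) = begin
        defect w t i   ≡⟨ defect-q i≡q ⟩
        - D            ≡⟨ +-identityˡ (- D) ⟨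
        0ℤ - D         ≡⟨ cong₂ _+_ (single-≢ D i≢p) (single-≡ (- D) i≡q) ⟨
        single p D i + single q (- D) i ∎
      by-cases (no i≢p) (no i≢q) = begin
        defect w t i   ≡⟨ defect-fixed {w} {t} (fixes i (off-orbits i∈ i≢p i≢q)) ⟩
        0ℤ             ≡⟨ cong₂ _+_ (single-≢ D i≢p) (single-≢ (- D) i≢q) ⟨
        single p D i + single q (- D) i ∎

-- The defining symmetries of the George groups

Periodic-0 : ∀ w → Periodic 0ℤ w
Periodic-0 w i = trans (cong w (+-identityʳ i)) (sym (+-identityʳ (w i)))

Periodic-+ : ∀ {w a b} → Periodic a w → Periodic b w → Periodic (a + b) w
Periodic-+ {w} {a} {b} per-a per-b i = begin
  w (i + (a + b)) ≡⟨ cong w (+-assoc i a b) ⟨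
  w (i + a + b)   ≡⟨ per-b (i + a) ⟩
  w (i + a) + b   ≡⟨ cong (_+ b) (per-a i) ⟩
  w i + a + b     ≡⟨ +-assoc (w i) a b ⟩
  w i + (a + b)   ∎
  where open ≡-Reasoning

Periodic-neg : ∀ {w a} → Periodic a w → Periodic (- a) w
Periodic-neg {w} {a} per i = begin
  w (i - a)         ≡⟨ add-sub (w (i - a)) a ⟨
  w (i - a) + a - a ≡⟨ cong (_- a) (per (i - a)) ⟨
  w (i - a + a) - a ≡⟨ cong (λ j → w j - a) (sub-add i a) ⟩
  w i - a           ∎
  where
  open ≡-Reasoning
  add-sub : ∀ i a → i + a - a ≡ i
  add-sub = solve-∀
  sub-add : ∀ i a → i - a + a ≡ i
  sub-add = solve-∀

Periodic-* : ∀ {w N} → Periodic N w → ∀ k → Periodic (k * N) w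
Periodic-* {w} {N} per (+ m)    = Periodic-ℕ* m
  where
  Periodic-ℕ* : ∀ m → Periodic (+ m * N) w
  Periodic-ℕ* zero    = Periodic-0 w
  Periodic-ℕ* (suc m) = subst (λ a → Periodic a w) (sym (suc-* (+ m) N)) (Periodic-+ {w} per (Periodic-ℕ* m))
Periodic-* {w} {N} per -[1+ m ] =
  subst (λ a → Periodic a w) (neg-distribˡ-* +[1+ m ] N) (Periodic-neg {w} (Periodic-* {w} per +[1+ m ]))

symAct : ∀ T n → Sign T × ℤ → ℤ → ℤ
symAct T n (s , k) = symMap T n s k

∣signVal∣≡1 : ∀ {T} (s : Sign T) → ∣ signVal s ∣ ≡ 1
∣signVal∣≡1 plus      = refl
∣signVal∣≡1 (minus _) = refl

symAct-isometry : ∀ T n g i j → ∣ symAct T n g i - symAct T n g j ∣ ≡ ∣ i - j ∣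
symAct-isometry T n (s , k) i j = begin
  ∣ c * i + k * N - (c * j + k * N) ∣ ≡⟨ cong ∣_∣ (translate c (k * N) i j) ⟩
  ∣ c * (i - j) ∣                     ≡⟨ abs-* c (i - j) ⟩
  ∣ c ∣ ℕ.* ∣ i - j ∣                 ≡⟨ cong (ℕ._* ∣ i - j ∣) (∣signVal∣≡1 s) ⟩
  1 ℕ.* ∣ i - j ∣                     ≡⟨ ℕ.*-identityˡ ∣ i - j ∣ ⟩
  ∣ i - j ∣                           ∎
  where
  open ≡-Reasoning
  c = signVal s
  N = period T n
  translate : ∀ c a i j → c * i + a - (c * j + a) ≡ c * (i - j)
  translate = solve-∀

symAct-equivariant : ∀ T n {w} → Periodic (period T n) w → (symmetric T → Odd-sym w)
  → Equivariant (symAct T n) w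
symAct-equivariant T n {w} per odd (plus , k) i = begin
  w (1ℤ * i + k * N)   ≡⟨ cong (λ j → w (j + k * N)) (*-identityˡ i) ⟩
  w (i + k * N)        ≡⟨ Periodic-* {w} per k i ⟩
  w i + k * N          ≡⟨ cong (_+ k * N) (*-identityˡ (w i)) ⟨
  1ℤ * w i + k * N     ∎
  where
  open ≡-Reasoning
  N = period T n
symAct-equivariant T n {w} per odd (minus sym-T , k) i = begin
  w (-1ℤ * i + k * N)  ≡⟨ cong (λ j → w (j + k * N)) (-1*i≡-i i) ⟩
  w (- i + k * N)      ≡⟨ Periodic-* {w} per k (- i) ⟩
  w (- i) + k * N      ≡⟨ cong (_+ k * N) (odd sym-T i) ⟩
  - w i + k * N        ≡⟨ cong (_+ k * N) (-1*i≡-i (w i)) ⟨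
  -1ℤ * w i + k * N    ∎
  where
  open ≡-Reasoning
  N = period T n

InGroup⇒Periodic : ∀ T n {w} → InGroup T n w → Periodic (period T n) w
InGroup⇒Periodic SA  n {w} _                   = Periodic-0 w
InGroup⇒Periodic SB  n {w} _                   = Periodic-0 w
InGroup⇒Periodic SD  n {w} _                   = Periodic-0 w
InGroup⇒Periodic ASA n     (_ , per , _)       = per
InGroup⇒Periodic ASC n     (_ , _ , per)       = per
InGroup⇒Periodic ASB n     ((_ , _ , per) , _) = per
InGroup⇒Periodic ASD n     ((_ , _ , per) , _) = per

InGroup⇒Odd-sym : ∀ T n {w} → InGroup T n w → symmetric T → Odd-sym w
InGroup⇒Odd-sym SB  n (_ , _ , odd)       _ = odd
InGroup⇒Odd-sym SD  n (_ , _ , odd , _)   _ = odd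
InGroup⇒Odd-sym ASC n (_ , odd , _)       _ = odd
InGroup⇒Odd-sym ASB n ((_ , odd , _) , _) _ = odd
InGroup⇒Odd-sym ASD n ((_ , odd , _) , _) _ = odd

InGroup⇒Equivariant : ∀ T n {w} → InGroup T n w → Equivariant (symAct T n) w
InGroup⇒Equivariant T n w∈W = symAct-equivariant T n (InGroup⇒Periodic T n w∈W) (InGroup⇒Odd-sym T n w∈W)

-- Each orbit meets the window exactly once

MultiplesGap : ℕ → ℤ → Set
MultiplesGap b N = ∀ k → k * N ≡ 0ℤ ⊎ b ℕ.≤ ∣ k * N ∣

MultiplesGap-0 : ∀ b → MultiplesGap b 0ℤ
MultiplesGap-0 b k = inj₁ (*-zeroʳ k)

nonzero-multiple : ∀ {b c} → b ℕ.≤ c → ∀ k j → ∣ k ∣ ≡ suc j → b ℕ.≤ ∣ k * + c ∣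
nonzero-multiple {b} {c} b≤c k j ∣k∣≡1+j = begin
  b                 ≤⟨ b≤c ⟩
  c                 ≤⟨ ℕ.m≤m+n c (j ℕ.* c) ⟩
  suc j ℕ.* c       ≡⟨ cong (ℕ._* c) ∣k∣≡1+j ⟨
  ∣ k ∣ ℕ.* ∣ + c ∣ ≡⟨ abs-* k (+ c) ⟨
  ∣ k * + c ∣       ∎
  where open ℕ.≤-Reasoning

MultiplesGap-+ : ∀ {b c} → b ℕ.≤ c → MultiplesGap b (+ c)
MultiplesGap-+ b≤c (+ zero)  = inj₁ refl
MultiplesGap-+ b≤c +[1+ j ] = inj₂ (nonzero-multiple b≤c +[1+ j ] j refl)
MultiplesGap-+ b≤c -[1+ j ] = inj₂ (nonzero-multiple b≤c -[1+ j ] j refl)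

window-dist : ∀ {n i j} → InWindow n i → InWindow n j → ∣ i - j ∣ ℕ.< n
window-dist {i = + zero} (+≤+ () , _) _
window-dist {j = + zero} _ (+≤+ () , _)
window-dist {i = +[1+ a ]} {+[1+ b ]} (_ , +≤+ a<n) (_ , +≤+ b<n) =
  subst (ℕ._< _) (cong ∣_∣ (sym ([1+m]⊖[1+n]≡m⊖n a b)))
    (ℕ.≤-<-trans (∣m⊝n∣≤m⊔n a b) (ℕ.⊔-lub a<n b<n))

window-sum : ∀ {n i j} → InWindow n i → InWindow n j → (i + j ≢ 0ℤ) × (∣ i + j ∣ ℕ.< suc (n ℕ.+ n))
window-sum {i = + zero} (+≤+ () , _) _
window-sum {j = + zero} _ (+≤+ () , _)
window-sum {i = +[1+ a ]} {+[1+ b ]} (_ , +≤+ a<n) (_ , +≤+ b<n) = (λ ()) , s≤s (ℕ.+-mono-≤ a<n b<n)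

window-diff-multiple : ∀ {n N i j} → MultiplesGap n N → InWindow n i → InWindow n j
  → ∀ k → i - j ≡ k * N → i ≡ j
window-diff-multiple {n} {N} {i} {j} gap i∈ j∈ k i-j≡kN with gap k
... | inj₁ kN≡0   = i-j≡0⇒i≡j i j (trans i-j≡kN kN≡0)
... | inj₂ n≤∣kN∣ =
  contradiction (subst (n ℕ.≤_) (cong ∣_∣ (sym i-j≡kN)) n≤∣kN∣) (ℕ.<⇒≱ (window-dist i∈ j∈))

window-sum-multiple : ∀ {n N i j} → MultiplesGap (suc (n ℕ.+ n)) N → InWindow n i → InWindow n j
  → ∀ k → i + j ≢ k * N
window-sum-multiple {n} {N} {i} {j} gap i∈ j∈ k i+j≡kN with gap k | window-sum i∈ j∈
... | inj₁ kN≡0   | i+j≢0 , _     = i+j≢0 (trans i+j≡kN kN≡0)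
... | inj₂ b≤∣kN∣ | _ , ∣i+j∣<b =
  ℕ.<⇒≱ ∣i+j∣<b (subst (_ ℕ.≤_) (cong ∣_∣ (sym i+j≡kN)) b≤∣kN∣)

2n+2≡[1+n]+[1+n] : ∀ n → 2 ℕ.* n ℕ.+ 2 ≡ suc n ℕ.+ suc n
2n+2≡[1+n]+[1+n] = NS.solve-∀

n≤2n+2 : ∀ n → n ℕ.≤ 2 ℕ.* n ℕ.+ 2
n≤2n+2 n = ℕ.≤-trans (ℕ.m≤m+n n (n ℕ.+ 0)) (ℕ.m≤m+n (2 ℕ.* n) 2)

1+n+n≤2n+2 : ∀ n → suc (n ℕ.+ n) ℕ.≤ 2 ℕ.* n ℕ.+ 2
1+n+n≤2n+2 n =
  subst (suc (n ℕ.+ n) ℕ.≤_) (sym (2n+2≡[1+n]+[1+n] n)) (s≤s (ℕ.+-monoʳ-≤ n (ℕ.n≤1+n n)))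

period-gap : ∀ T n → MultiplesGap n (period T n)
period-gap SA  n = MultiplesGap-0 n
period-gap SB  n = MultiplesGap-0 n
period-gap SD  n = MultiplesGap-0 n
period-gap ASA n = MultiplesGap-+ ℕ.≤-refl
period-gap ASC n = MultiplesGap-+ (n≤2n+2 n)
period-gap ASB n = MultiplesGap-+ (n≤2n+2 n)
period-gap ASD n = MultiplesGap-+ (n≤2n+2 n)

period-gap-symmetric : ∀ T n → symmetric T → MultiplesGap (suc (n ℕ.+ n)) (period T n)
period-gap-symmetric SB  n _ = MultiplesGap-0 _
period-gap-symmetric SD  n _ = MultiplesGap-0 _
period-gap-symmetric ASC n _ = MultiplesGap-+ (1+n+n≤2n+2 n)
period-gap-symmetric ASB n _ = MultiplesGap-+ (1+n+n≤2n+2 n)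
period-gap-symmetric ASD n _ = MultiplesGap-+ (1+n+n≤2n+2 n)

[cz+kN]-[cz+k′N]≡[k-k′]N : ∀ c z k k′ N → (c * z + k * N) - (c * z + k′ * N) ≡ (k - k′) * N
[cz+kN]-[cz+k′N]≡[k-k′]N = solve-∀

[cz+kN]+[-cz+k′N]≡[k+k′]N : ∀ c z k k′ N → (c * z + k * N) + (- c * z + k′ * N) ≡ (k + k′) * N
[cz+kN]+[-cz+k′N]≡[k+k′]N = solve-∀

symAct-transversal : ∀ T n g h z → InWindow n (symAct T n g z) → InWindow n (symAct T n h z)
  → symAct T n g z ≡ symAct T n h z
symAct-transversal T n (plus , k) (plus , k′) z g∈ h∈ =
  window-diff-multiple (period-gap T n) g∈ h∈ (k - k′) ([cz+kN]-[cz+k′N]≡[k-k′]N 1ℤ z k k′ (period T n))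
symAct-transversal T n (minus _ , k) (minus _ , k′) z g∈ h∈ =
  window-diff-multiple (period-gap T n) g∈ h∈ (k - k′) ([cz+kN]-[cz+k′N]≡[k-k′]N -1ℤ z k k′ (period T n))
symAct-transversal T n (plus , k) (minus sym-T , k′) z g∈ h∈ =
  contradiction
    ([cz+kN]+[-cz+k′N]≡[k+k′]N 1ℤ z k k′ (period T n))
    (window-sum-multiple (period-gap-symmetric T n sym-T) g∈ h∈ (k + k′))
symAct-transversal T n (minus sym-T , k) (plus , k′) z g∈ h∈ =
  contradiction
    ([cz+kN]+[-cz+k′N]≡[k+k′]N -1ℤ z k k′ (period T n))
    (window-sum-multiple (period-gap-symmetric T n sym-T) g∈ h∈ (k + k′))

residue : ∀ z d .{{_ : ℕ.NonZero d}} → ∃₂ λ k r → (r ℕ.< d) × (z + k * + d ≡ + r)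
residue z d = - q , r , n%ℕd<d z d , (begin
  z + - q * + d                ≡⟨ cong (_+ - q * + d) (a≡a%ℕn+[a/ℕn]*n z d) ⟩
  + r + q * + d + - q * + d    ≡⟨ cancel (+ r) q (+ d) ⟩
  + r                          ∎)
  where
  open ≡-Reasoning
  q = z /ℕ d
  r = z %ℕ d
  cancel : ∀ r q d → r + q * d + - q * d ≡ r
  cancel = solve-∀

Odd-sym⇒fixes-0 : ∀ {u} → Odd-sym u → u 0ℤ ≡ 0ℤ
Odd-sym⇒fixes-0 {u} odd = i≡-i⇒i≡0 (odd 0ℤ)

Odd-sym⇒fixes-half-period : ∀ {u a} → Odd-sym u → Periodic (a + a) u → u a ≡ a
Odd-sym⇒fixes-half-period {u} {a} odd per = i-j≡0⇒i≡j (u a) a (i≡-i⇒i≡0 (begin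
  u a - a                   ≡⟨ cong (λ j → u j - a) (reflect a) ⟨
  u (- a + (a + a)) - a     ≡⟨ cong (_- a) (per (- a)) ⟩
  u (- a) + (a + a) - a     ≡⟨ cong (λ j → j + (a + a) - a) (odd a) ⟩
  - u a + (a + a) - a       ≡⟨ negate (u a) a ⟩
  - (u a - a)               ∎))
  where
  open ≡-Reasoning
  reflect : ∀ a → - a + (a + a) ≡ a
  reflect = solve-∀
  negate : ∀ b a → - b + (a + a) - a ≡ - (b - a)
  negate = solve-∀

Periodic⇒fixes-congruent : ∀ {u N z a} → Periodic N u → ∀ k → z + k * N ≡ a → u a ≡ a → u z ≡ z
Periodic⇒fixes-congruent {u} {N} {z} {a} per k z+kN≡a ua≡a = begin
  u z                   ≡⟨ cancel (u z) (k * N) ⟨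
  u z + k * N - k * N   ≡⟨ cong (_- k * N) (Periodic-* {u} per k z) ⟨
  u (z + k * N) - k * N ≡⟨ cong (λ j → u j - k * N) z+kN≡a ⟩
  u a - k * N           ≡⟨ cong (_- k * N) (trans ua≡a (sym z+kN≡a)) ⟩
  z + k * N - k * N     ≡⟨ cancel z (k * N) ⟩
  z                     ∎
  where
  open ≡-Reasoning
  cancel : ∀ i j → i + j - j ≡ i
  cancel = solve-∀

reflect-window : ∀ n {r} → suc n ℕ.< r → r ℕ.< 2 ℕ.* n ℕ.+ 2 → InWindow n (+ (2 ℕ.* n ℕ.+ 2) - + r)
reflect-window n {r} 1+n<r r<c = subst (InWindow n) (sym c-r≡c∸r) (+≤+ (ℕ.m<n⇒0<n∸m r<c) , +≤+ c∸r≤n)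
  where
  c = 2 ℕ.* n ℕ.+ 2
  c-r≡c∸r : + c - + r ≡ + (c ℕ.∸ r)
  c-r≡c∸r = trans (m-n≡m⊖n c r) (⊖-≥ (ℕ.<⇒≤ r<c))
  c∸r≤n : c ℕ.∸ r ℕ.≤ n
  c∸r≤n = begin
    c ℕ.∸ r                   ≤⟨ ℕ.∸-monoʳ-≤ c 1+n<r ⟩
    c ℕ.∸ suc (suc n)         ≡⟨ cong (ℕ._∸ suc (suc n)) (2n+2≡[1+n]+[1+n] n) ⟩
    suc n ℕ.+ suc n ℕ.∸ suc (suc n) ≡⟨ ℕ.m+n∸n≡m n (suc n) ⟩
    n                         ∎
    where open ℕ.≤-Reasoning

affA-window : ∀ m z → ∃ λ k → InWindow (suc m) (z + k * + suc m)
affA-window m z with residue (z - 1ℤ) (suc m)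
... | k , r , r<n , z-1+kN≡r = k , subst (InWindow (suc m)) (sym z+kN≡1+r) (+≤+ (s≤s z≤n) , +≤+ r<n)
  where
  shift : ∀ z a → z + a ≡ 1ℤ + (z - 1ℤ + a)
  shift = solve-∀
  z+kN≡1+r : z + k * + suc m ≡ + suc r
  z+kN≡1+r = trans (shift z (k * + suc m)) (cong (λ j → 1ℤ + j) z-1+kN≡r)

residue-classes : ∀ n r → r ℕ.< 2 ℕ.* n ℕ.+ 2
  → r ≡ 0 ⊎ InWindow n (+ r) ⊎ r ≡ suc n ⊎ InWindow n (+ (2 ℕ.* n ℕ.+ 2) - + r)
residue-classes n zero    _ = inj₁ refl
residue-classes n (suc j) r<c with suc j ℕ.≤? n
... | yes r≤n = inj₂ (inj₁ (+≤+ (s≤s z≤n) , +≤+ r≤n))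
... | no r≰n with ℕ.m≤n⇒m<n∨m≡n (ℕ.≰⇒> r≰n)
...   | inj₂ 1+n≡r  = inj₂ (inj₂ (inj₁ (sym 1+n≡r)))
...   | inj₁ 1+n<r = inj₂ (inj₂ (inj₂ (reflect-window n 1+n<r r<c)))

-- Every element of S~^C_n fixes the residue classes of 0 and n + 1 mod 2n + 2,
-- which miss the window; every other class meets it up to sign.
affC-window : ∀ n {u z} → InAffC n u → u z ≢ z
  → (∃ λ k → InWindow n (z + k * + (2 ℕ.* n ℕ.+ 2)))
  ⊎ (∃ λ k → InWindow n (- z + k * + (2 ℕ.* n ℕ.+ 2)))
affC-window n {u} {z} (_ , odd , per) uz≢z =
  from-residue (residue z (2 ℕ.* n ℕ.+ 2) {{subst ℕ.NonZero (sym (2n+2≡[1+n]+[1+n] n)) _}})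
  where
  N = + (2 ℕ.* n ℕ.+ 2)
  per′ : Periodic (+ suc n + + suc n) u
  per′ = subst (λ a → Periodic (+ a) u) (2n+2≡[1+n]+[1+n] n) per
  reflect : ∀ z k N → - z + (1ℤ - k) * N ≡ N - (z + k * N)
  reflect = solve-∀
  from-residue : (∃₂ λ k r → (r ℕ.< 2 ℕ.* n ℕ.+ 2) × (z + k * N ≡ + r))
    → (∃ λ k → InWindow n (z + k * N)) ⊎ (∃ λ k → InWindow n (- z + k * N))
  from-residue (k , r , r<c , z+kN≡r) with residue-classes n r r<c
  ... | inj₁ refl =
    contradiction (Periodic⇒fixes-congruent {u} per k z+kN≡r (Odd-sym⇒fixes-0 odd)) uz≢z
  ... | inj₂ (inj₁ r∈) = inj₁ (k , subst (InWindow n) (sym z+kN≡r) r∈)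
  ... | inj₂ (inj₂ (inj₁ refl)) =
    contradiction (Periodic⇒fixes-congruent {u} per k z+kN≡r (Odd-sym⇒fixes-half-period odd per′)) uz≢z
  ... | inj₂ (inj₂ (inj₂ N-r∈)) =
    inj₂ (1ℤ - k , subst (InWindow n) (sym (trans (reflect z k N) (cong (λ j → N - j) z+kN≡r))) N-r∈)

shifted-or-reflected⇒MeetsWindow : ∀ T n {z}
  → (∃ λ k → InWindow n (z + k * period T n)) ⊎ (symmetric T × ∃ λ k → InWindow n (- z + k * period T n))
  → MeetsWindow (symAct T n) n z
shifted-or-reflected⇒MeetsWindow T n {z} (inj₁ (k , z+kN∈)) =
  (plus , k) , subst (λ j → InWindow n (j + k * period T n)) (sym (*-identityˡ z)) z+kN∈
shifted-or-reflected⇒MeetsWindow T n {z} (inj₂ (sym-T , k , -z+kN∈)) =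
  (minus sym-T , k) , subst (λ j → InWindow n (j + k * period T n)) (sym (-1*i≡-i z)) -z+kN∈

unshifted : ∀ {n z} N → InWindow n z → ∃ λ k → InWindow n (z + k * N)
unshifted {n} {z} N z∈ = 0ℤ , subst (InWindow n) (sym (+-identityʳ z)) z∈

moved⇒MeetsWindow : ∀ T m {u z} → InGroup T (suc m) u → u z ≢ z → InDomain T (suc m) z
  → MeetsWindow (symAct T (suc m)) (suc m) z
moved⇒MeetsWindow SA m _ _ z∈ =
  shifted-or-reflected⇒MeetsWindow SA (suc m) (inj₁ (unshifted 0ℤ z∈))
moved⇒MeetsWindow SB m _ _ (inj₁ z∈) =
  shifted-or-reflected⇒MeetsWindow SB (suc m) (inj₁ (unshifted 0ℤ z∈))
moved⇒MeetsWindow SB m _ _ (inj₂ -z∈) =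
  shifted-or-reflected⇒MeetsWindow SB (suc m) (inj₂ (tt , unshifted 0ℤ -z∈))
moved⇒MeetsWindow SD m _ _ (inj₁ z∈) =
  shifted-or-reflected⇒MeetsWindow SD (suc m) (inj₁ (unshifted 0ℤ z∈))
moved⇒MeetsWindow SD m _ _ (inj₂ -z∈) =
  shifted-or-reflected⇒MeetsWindow SD (suc m) (inj₂ (tt , unshifted 0ℤ -z∈))
moved⇒MeetsWindow ASA m {z = z} _ _ _ =
  shifted-or-reflected⇒MeetsWindow ASA (suc m) (inj₁ (affA-window m z))
moved⇒MeetsWindow ASC m u∈W uz≢z _ =
  shifted-or-reflected⇒MeetsWindow ASC (suc m) (Sum.map₂ (tt ,_) (affC-window (suc m) u∈W uz≢z))
moved⇒MeetsWindow ASB m (u∈C , _) uz≢z _ =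
  shifted-or-reflected⇒MeetsWindow ASB (suc m) (Sum.map₂ (tt ,_) (affC-window (suc m) u∈C uz≢z))
moved⇒MeetsWindow ASD m (u∈C , _) uz≢z _ =
  shifted-or-reflected⇒MeetsWindow ASD (suc m) (Sum.map₂ (tt ,_) (affC-window (suc m) u∈C uz≢z))

IsTransposition⇒SwapsOrbits : ∀ T n {x y t} → IsTransposition T n x y t → SwapsOrbits (symAct T n) x y t
IsTransposition⇒SwapsOrbits T n (swaps , fixes) =
  (λ (s , k) → swaps s k) , (λ i off → fixes i (λ s k → off (s , k)))

lemma3p5 : (T : GeorgeType) (n : ℕ) (w : ℤ → ℤ) (x y : ℤ) (t : ℤ → ℤ)
    → InGroup T n w
    → Transposable T n x y
    → IsTransposition T n x y t
    → (y ≤ w x) × (x < y) × (w y ≤ x)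
    → + tvd n (w ∘ t) ≡ + tvd n w - + tvd n t
lemma3p5 T zero    w x y t _ _ _ _ = refl
lemma3p5 T (suc m) w x y t w∈W (x≢y , x∈ , y∈ , u , u∈W , ux≡y , uy≡x) t-swaps (y≤wx , x<y , wy≤x) =
  tvd-∘-swap (InGroup⇒Equivariant T n w∈W) (IsTransposition⇒SwapsOrbits T n t-swaps)
    (moved⇒MeetsWindow T m u∈W (λ ux≡x → x≢y (trans (sym ux≡x) ux≡y)) x∈)
    (moved⇒MeetsWindow T m u∈W (λ uy≡y → x≢y (trans (sym uy≡x) uy≡y)) y∈)
    y≤wx x<y wy≤x
  where
  n = suc m
  open OrbitTransposition (symAct T n) n (symAct-isometry T n) (symAct-transversal T n)
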